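{- For $n\geq 0$ let $F_n$ be the bouquet with signed rotation $[e_1,e_2,e_1,e_3,e_2,\ldots,e_{n-1},e_{n-2},e_n,e_{n-1},e_n]$ (so $F_0$ has no loops and $F_1=[e_1,e_1]$). Let $B_n$ be any partial Petrial of $F_n$. Then $B_n$ can be transformed, by a finite sequence of Operations 1–4, into either an isolated vertex (the empty signed rotation $[\emptyset]$) or a vertex with exactly one orientable loop (signed rotation $[e,e]$).
   Context: A bouquet is a ribbon graph with exactly one vertex disc, its edges being loops. A signed rotation of a bouquet is the cyclic ordering of the loop ends around the vertex, where an orientable (untwisted) loop has both ends with the same sign and a non-orientable (twisted) loop has ends with opposite signs; $+$ is omitted; reversing both signs of a loop gives an equivalent signed rotation and the cyclic starting point is irrelevant. For a set $A$ of loops, the partial Petrial $B^{\times|A}$ is obtained by adding a half-twist to each loop in $A$, i.e. toggling the sign of one end of each loop in $A$. For a string $P=p_1p_2\cdots p_k$ its inverse is $P^{ -1}=(-p_k)\cdots(-p_2)(-p_1)$. With $P,Q$ (possibly empty) strings and $a,b$ loop labels, the operations on signed rotations are: Operation 1: $PaQba\mapsto PabQa$; Operation 2: $P(-a)Qba\mapsto P(-b)(-a)Qa$; Operation 3: $Pabab\mapsto P$; Operation 4: $P(-a)a\mapsto P$. -}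

module Defs where

open import Data.Nat using (ℕ; zero; suc; _≟_)
open import Data.Bool using (Bool; true; false; if_then_else_)
open import Data.List using (List; []; _∷_; _++_; _∷ʳ_; concatMap; upTo)
open import Data.List.Membership.DecPropositional _≟_ using (_∈?_)
open import Data.Product using (_×_; _,_)
open import Relation.Nullary using (yes; no)
open import Relation.Binary.PropositionalEquality using (_≢_)
open import Relation.Binary.Construct.Closure.ReflexiveTransitive using (Star)

data Sign : Set where
  ⊕ ⊖ : Sign

neg : Sign → Sign
neg ⊕ = ⊖
neg ⊖ = ⊕

Letter : Set
Letter = Sign × ℕ

-- A signed rotation is represented by a word; the cyclic starting point and
-- reversing both signs of a loop are handled as equivalence steps below.
Word : Set
Word = List Letter

pos : ℕ → Letter
pos a = ⊕ , a

ng : ℕ → Letter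
ng a = ⊖ , a

flipLoop : ℕ → Word → Word
flipLoop l [] = []
flipLoop l ((s , m) ∷ w) with l ≟ m
... | yes _ = (neg s , m) ∷ flipLoop l w
... | no _  = (s , m) ∷ flipLoop l w

data Step : Word → Word → Set where
  rotate : ∀ x w → Step (x ∷ w) (w ∷ʳ x)
  flipL  : ∀ l w → Step w (flipLoop l w)
  op1 : ∀ P Q a b → a ≢ b →
        Step (P ++ pos a ∷ Q ++ pos b ∷ pos a ∷ [])
             (P ++ pos a ∷ pos b ∷ Q ++ pos a ∷ [])
  op2 : ∀ P Q a b → a ≢ b →
        Step (P ++ ng a ∷ Q ++ pos b ∷ pos a ∷ [])
             (P ++ ng b ∷ ng a ∷ Q ++ pos a ∷ [])
  op3 : ∀ P a b → a ≢ b →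
        Step (P ++ pos a ∷ pos b ∷ pos a ∷ pos b ∷ []) P
  op4 : ∀ P a →
        Step (P ++ ng a ∷ pos a ∷ []) P

_⟶*_ : Word → Word → Set
_⟶*_ = Star Step

-- label word of F_n : [e1, e2,e1, e3,e2, ..., en,e(n-1), en], e_k = k
FLabels : ℕ → List ℕ
FLabels zero = []
FLabels (suc m) = 1 ∷ concatMap (λ k → suc (suc k) ∷ suc k ∷ []) (upTo m) ++ suc m ∷ []

F : ℕ → Word
F n = Data.List.map pos (FLabels n)

-- partial Petrial w.r.t. the set of loops A (a decidable subset of labels):
-- toggle the sign of the first end of each loop in A.
petrialGo : (ℕ → Bool) → List ℕ → Word → Word
petrialGo A seen [] = []
petrialGo A seen ((s , l) ∷ w) with A l | l ∈? seen
... | true | no _ = (neg s , l) ∷ petrialGo A (l ∷ seen) w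
... | _    | _    = (s , l) ∷ petrialGo A seen w

partialPetrial : Word → (ℕ → Bool) → Word
partialPetrial w A = petrialGo A [] w

{-# OPTIONS --safe #-}
module Submission where

open import Defs
open import Data.Nat using (ℕ; zero; suc; _≤_; _<_; _≟_)
open import Data.Nat.Properties using (<⇒≢; ≤-refl; n<1+n; m<n⇒m<1+n; m≤n⇒m≤1+n; 1+n≰n; 1+n≢n)
open import Data.Bool using (Bool; true; false)
open import Data.Bool.Properties using (not-¬)
open import Data.List using (List; []; _∷_; _++_; map; concatMap; applyUpTo)
open import Data.List.Properties using (++-assoc; ++-identityʳ)
open import Data.List.Membership.Propositional using (_∈_)
open import Data.List.Membership.DecPropositional _≟_ using (_∈?_)
open import Data.List.Relation.Unary.All as All using (All; []; _∷_)
open import Data.List.Relation.Unary.Any using (here; there)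
open import Data.Sum using (_⊎_; inj₁; inj₂)
open import Data.Product using (∃; ∃₂; _,_)
open import Data.Empty using (⊥-elim)
open import Function using (_∘_; id)
open import Relation.Nullary using (yes; no)
open import Relation.Binary.PropositionalEquality using (_≡_; _≢_; refl; sym; trans; cong; subst; ≢-sym)
open import Relation.Binary.Construct.Closure.ReflexiveTransitive using (ε; _◅_; _◅◅_)
open import Relation.Binary.Construct.Closure.ReflexiveTransitive.Properties using (module StarReasoning)

-- A partial Petrial of F_n is [s e₁, t₂ e₂, e₁, t₃ e₃, e₂, …, t_n e_n, e_{n-1}, e_n]: only
-- first ends can be twisted.  The operations peel loops off the front of such a word and
-- leave a word of the same shape.  A twisted e_j is removed by Operations 2 and 4, which
-- toggles the twist of e_{j+1}.  An untwisted e_j is removed together with e_{j+1}: by three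
-- Operations 1 and an Operation 3 if e_{j+1} is untwisted (conjugated by the sign reversal
-- of e_{j+2} when e_{j+2} is twisted), and otherwise by sign reversals, an Operation 2 and
-- two removals of twisted loops.  What is left at the end is [e,e], or one of [-e,e],
-- [e,e',e,e'] and [e,-e',e,e'], each of which reduces to [∅].

open StarReasoning Step

neg-involutive : ∀ s → neg (neg s) ≡ s
neg-involutive ⊕ = refl
neg-involutive ⊖ = refl

-- flipLoop l only computes once l ≟ m is decided; these evaluate it letter by letter.
infixr 5 _≢∷_ ≡∷_

_≢∷_ : ∀ {l m s w w'} → l ≢ m → flipLoop l w ≡ w' → flipLoop l ((s , m) ∷ w) ≡ (s , m) ∷ w'
_≢∷_ {l} {m} l≢m eq with l ≟ m
... | yes l≡m = ⊥-elim (l≢m l≡m)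
... | no _    = cong (_ ∷_) eq

≡∷_ : ∀ {l s w w'} → flipLoop l w ≡ w' → flipLoop l ((s , l) ∷ w) ≡ (neg s , l) ∷ w'
≡∷_ {l} eq with l ≟ l
... | yes _   = cong (_ ∷_) eq
... | no l≢l  = ⊥-elim (l≢l refl)

flipLoop-involutive : ∀ l w → flipLoop l (flipLoop l w) ≡ w
flipLoop-involutive l [] = refl
flipLoop-involutive l ((s , m) ∷ w) with l ≟ m
flipLoop-involutive l ((⊕ , m) ∷ w) | yes refl = ≡∷ flipLoop-involutive l w
flipLoop-involutive l ((⊖ , m) ∷ w) | yes refl = ≡∷ flipLoop-involutive l w
... | no l≢m = l≢m ≢∷ flipLoop-involutive l w

rotate-++ : ∀ xs ys → (xs ++ ys) ⟶* (ys ++ xs)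
rotate-++ [] ys = begin
  ys       ≡⟨ ++-identityʳ ys ⟨
  ys ++ [] ∎
rotate-++ (x ∷ xs) ys = begin
  x ∷ xs ++ ys           ⟶⟨ rotate x (xs ++ ys) ⟩
  (xs ++ ys) ++ x ∷ []   ≡⟨ ++-assoc xs ys (x ∷ []) ⟩
  xs ++ ys ++ x ∷ []     ⟶*⟨ rotate-++ xs (ys ++ x ∷ []) ⟩
  (ys ++ x ∷ []) ++ xs   ≡⟨ ++-assoc ys (x ∷ []) xs ⟩
  ys ++ x ∷ xs           ∎

flipped : ∀ l {w w'} → flipLoop l w ≡ w' → Step w w'
flipped l {w} refl = flipL l w

⟶*-conjugate : ∀ l {w w' v v'} → flipLoop l w ≡ v → flipLoop l w' ≡ v' → v ⟶* v' → w ⟶* w'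
⟶*-conjugate l {w' = w'} w↦v refl v⟶*v' =
  flipped l w↦v ◅ v⟶*v' ◅◅ flipped l (flipLoop-involutive l w') ◅ ε

collapse-twisted⁺ : ∀ {a b R} → a ≢ b → (ng a ∷ pos b ∷ pos a ∷ R) ⟶* (ng b ∷ R)
collapse-twisted⁺ {a} {b} {R} a≢b = begin
  ng a ∷ pos b ∷ pos a ∷ R               ⟶*⟨ rotate-++ (ng a ∷ pos b ∷ pos a ∷ []) R ⟩
  R ++ ng a ∷ pos b ∷ pos a ∷ []         ⟶⟨ op2 R [] a b a≢b ⟩
  R ++ ng b ∷ ng a ∷ pos a ∷ []          ≡⟨ ++-assoc R (ng b ∷ []) (ng a ∷ pos a ∷ []) ⟨
  (R ++ ng b ∷ []) ++ ng a ∷ pos a ∷ []  ⟶⟨ op4 (R ++ ng b ∷ []) a ⟩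
  R ++ ng b ∷ []                         ⟶*⟨ rotate-++ R (ng b ∷ []) ⟩
  ng b ∷ R                               ∎

collapse-twisted : ∀ {a b R} → a ≢ b → ∀ t → (ng a ∷ (t , b) ∷ pos a ∷ R) ⟶* ((neg t , b) ∷ R)
collapse-twisted a≢b ⊕ = collapse-twisted⁺ a≢b
collapse-twisted a≢b ⊖ =
  ⟶*-conjugate _ (b≢a ≢∷ ≡∷ b≢a ≢∷ refl) (≡∷ refl) (collapse-twisted⁺ a≢b)
  where b≢a = ≢-sym a≢b

collapse-interlaced⁺ : ∀ {a b c R} → a ≢ b → b ≢ c →
  (pos a ∷ pos b ∷ pos a ∷ pos c ∷ pos b ∷ R) ⟶* (pos c ∷ R)
collapse-interlaced⁺ {a} {b} {c} {R} a≢b b≢c = begin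
  pos a ∷ pos b ∷ pos a ∷ pos c ∷ pos b ∷ R
    ⟶*⟨ rotate-++ (pos a ∷ pos b ∷ []) (pos a ∷ pos c ∷ pos b ∷ R) ⟩
  pos a ∷ pos c ∷ pos b ∷ R ++ pos a ∷ pos b ∷ []
    ⟶⟨ op1 (pos a ∷ pos c ∷ []) R b a (≢-sym a≢b) ⟩
  pos a ∷ pos c ∷ pos b ∷ pos a ∷ R ++ pos b ∷ []
    ⟶⟨ rotate (pos a) _ ⟩
  pos c ∷ pos b ∷ pos a ∷ (R ++ pos b ∷ []) ++ pos a ∷ []
    ≡⟨ cong (λ z → pos c ∷ pos b ∷ pos a ∷ z) (++-assoc R (pos b ∷ []) (pos a ∷ [])) ⟩
  pos c ∷ pos b ∷ pos a ∷ R ++ pos b ∷ pos a ∷ []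
    ⟶⟨ op1 (pos c ∷ pos b ∷ []) R a b a≢b ⟩
  pos c ∷ pos b ∷ pos a ∷ pos b ∷ R ++ pos a ∷ []
    ⟶*⟨ rotate-++ (pos c ∷ pos b ∷ []) (pos a ∷ pos b ∷ R ++ pos a ∷ []) ⟩
  pos a ∷ pos b ∷ (R ++ pos a ∷ []) ++ pos c ∷ pos b ∷ []
    ⟶⟨ op1 (pos a ∷ []) (R ++ pos a ∷ []) b c b≢c ⟩
  pos a ∷ pos b ∷ pos c ∷ (R ++ pos a ∷ []) ++ pos b ∷ []
    ≡⟨ cong (λ z → pos a ∷ pos b ∷ pos c ∷ z) (++-assoc R (pos a ∷ []) (pos b ∷ [])) ⟩
  pos a ∷ pos b ∷ pos c ∷ R ++ pos a ∷ pos b ∷ []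
    ⟶*⟨ rotate-++ (pos a ∷ pos b ∷ pos c ∷ R) (pos a ∷ pos b ∷ []) ⟩
  pos a ∷ pos b ∷ pos a ∷ pos b ∷ pos c ∷ R
    ⟶*⟨ rotate-++ (pos a ∷ pos b ∷ pos a ∷ pos b ∷ []) (pos c ∷ R) ⟩
  pos c ∷ R ++ pos a ∷ pos b ∷ pos a ∷ pos b ∷ []
    ⟶⟨ op3 (pos c ∷ R) a b a≢b ⟩
  pos c ∷ R
    ∎

collapse-interlaced : ∀ {a b c R} → a ≢ b → b ≢ c → a ≢ c → ∀ u →
  (pos a ∷ pos b ∷ pos a ∷ (u , c) ∷ pos b ∷ R) ⟶* ((u , c) ∷ R)
collapse-interlaced a≢b b≢c a≢c ⊕ = collapse-interlaced⁺ a≢b b≢c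
collapse-interlaced a≢b b≢c a≢c ⊖ =
  ⟶*-conjugate _ (c≢a ≢∷ c≢b ≢∷ c≢a ≢∷ ≡∷ c≢b ≢∷ refl) (≡∷ refl) (collapse-interlaced⁺ a≢b b≢c)
  where
  c≢a = ≢-sym a≢c
  c≢b = ≢-sym b≢c

collapse-interlaced-twisted : ∀ {a b c R} → a ≢ b → b ≢ c → a ≢ c →
  flipLoop a R ≡ R → flipLoop b R ≡ R → ∀ u →
  (pos a ∷ ng b ∷ pos a ∷ (u , c) ∷ pos b ∷ R) ⟶* ((u , c) ∷ R)
collapse-interlaced-twisted {a} {b} {c} {R} a≢b b≢c a≢c a-fresh b-fresh u = begin
  pos a ∷ ng b ∷ pos a ∷ x ∷ pos b ∷ R
    ⟶⟨ flipped b (b≢a ≢∷ ≡∷ b≢a ≢∷ b≢c ≢∷ ≡∷ b-fresh) ⟩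
  pos a ∷ pos b ∷ pos a ∷ x ∷ ng b ∷ R
    ⟶*⟨ rotate-++ (pos a ∷ pos b ∷ []) (pos a ∷ x ∷ ng b ∷ R) ⟩
  pos a ∷ x ∷ ng b ∷ R ++ pos a ∷ pos b ∷ []
    ⟶⟨ op2 (pos a ∷ x ∷ []) R b a b≢a ⟩
  pos a ∷ x ∷ ng a ∷ ng b ∷ R ++ pos b ∷ []
    ⟶*⟨ rotate-++ (pos a ∷ x ∷ ng a ∷ ng b ∷ R) (pos b ∷ []) ⟩
  pos b ∷ pos a ∷ x ∷ ng a ∷ ng b ∷ R
    ⟶⟨ flipped a (a≢b ≢∷ ≡∷ a≢c ≢∷ ≡∷ a≢b ≢∷ a-fresh) ⟩
  pos b ∷ ng a ∷ x ∷ pos a ∷ ng b ∷ R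
    ⟶⟨ flipped b (≡∷ b≢a ≢∷ b≢c ≢∷ b≢a ≢∷ ≡∷ b-fresh) ⟩
  ng b ∷ ng a ∷ x ∷ pos a ∷ pos b ∷ R
    ⟶*⟨ rotate-++ (ng b ∷ []) (ng a ∷ x ∷ pos a ∷ pos b ∷ R) ⟩
  ng a ∷ x ∷ pos a ∷ pos b ∷ R ++ ng b ∷ []
    ⟶*⟨ collapse-twisted a≢c u ⟩
  (neg u , c) ∷ pos b ∷ R ++ ng b ∷ []
    ⟶*⟨ rotate-++ ((neg u , c) ∷ pos b ∷ R) (ng b ∷ []) ⟩
  ng b ∷ (neg u , c) ∷ pos b ∷ R
    ⟶*⟨ collapse-twisted b≢c (neg u) ⟩
  (neg (neg u) , c) ∷ R
    ≡⟨ cong (λ s → (s , c) ∷ R) (neg-involutive u) ⟩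
  x ∷ R
    ∎
  where
  x = (u , c)
  b≢a = ≢-sym a≢b

chain : ℕ → List Sign → Word
chain j []       = pos j ∷ []
chain j (t ∷ ts) = (t , suc j) ∷ pos j ∷ chain (suc j) ts

flipLoop-chain : ∀ {l j} ts → l < j → flipLoop l (chain j ts) ≡ chain j ts
flipLoop-chain []       l<j = <⇒≢ l<j ≢∷ refl
flipLoop-chain (t ∷ ts) l<j = <⇒≢ l<1+j ≢∷ <⇒≢ l<j ≢∷ flipLoop-chain ts l<1+j
  where l<1+j = m<n⇒m<1+n l<j

Reducible : Word → Set
Reducible w = (w ⟶* []) ⊎ ∃ (λ e → w ⟶* (pos e ∷ pos e ∷ []))

Reducible-◅◅ : ∀ {w w'} → w ⟶* w' → Reducible w' → Reducible w
Reducible-◅◅ w⟶*w' (inj₁ w'⟶*[])     = inj₁ (w⟶*w' ◅◅ w'⟶*[])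
Reducible-◅◅ w⟶*w' (inj₂ (e , w'⟶*ee)) = inj₂ (e , w⟶*w' ◅◅ w'⟶*ee)

n≢1+n : ∀ n → n ≢ suc n
n≢1+n n = <⇒≢ (n<1+n n)

n<2+n : ∀ n → n < suc (suc n)
n<2+n n = m<n⇒m<1+n (n<1+n n)

reducible-chain : ∀ ts j s → Reducible ((s , j) ∷ chain j ts)
reducible-chain []           j ⊕ = inj₂ (j , ε)
reducible-chain []           j ⊖ = inj₁ (op4 [] j ◅ ε)
reducible-chain (t ∷ ts)     j ⊖ =
  Reducible-◅◅ (collapse-twisted (n≢1+n j) t) (reducible-chain ts (suc j) (neg t))
reducible-chain (⊕ ∷ [])     j ⊕ = inj₁ (op3 [] j (suc j) (n≢1+n j) ◅ ε)
reducible-chain (⊖ ∷ [])     j ⊕ =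
  Reducible-◅◅ (rotate (pos j) _ ◅ collapse-twisted 1+n≢n ⊕) (reducible-chain [] j ⊖)
reducible-chain (⊕ ∷ u ∷ ts) j ⊕ =
  Reducible-◅◅ (collapse-interlaced (n≢1+n j) (n≢1+n (suc j)) (<⇒≢ (n<2+n j)) u)
    (reducible-chain ts (suc (suc j)) u)
reducible-chain (⊖ ∷ u ∷ ts) j ⊕ =
  Reducible-◅◅
    (collapse-interlaced-twisted (n≢1+n j) (n≢1+n (suc j)) (<⇒≢ (n<2+n j))
      (flipLoop-chain ts (n<2+n j)) (flipLoop-chain ts (n<1+n (suc j))) u)
    (reducible-chain ts (suc (suc j)) u)

chainLabels : ℕ → ℕ → List ℕ
chainLabels j zero    = j ∷ []
chainLabels j (suc k) = suc j ∷ j ∷ chainLabels (suc j) k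

applyUpTo-chainLabels : ∀ k f → (∀ i → f (suc i) ≡ suc (f i)) →
  concatMap (λ i → suc (suc i) ∷ suc i ∷ []) (applyUpTo f k) ++ suc (f k) ∷ []
    ≡ chainLabels (suc (f 0)) k
applyUpTo-chainLabels zero    f f-suc = refl
applyUpTo-chainLabels (suc k) f f-suc =
  cong (λ ls → suc (suc (f 0)) ∷ suc (f 0) ∷ ls)
    (trans (applyUpTo-chainLabels k (f ∘ suc) (f-suc ∘ suc))
           (cong (λ j → chainLabels (suc j) k) (f-suc 0)))

F-suc : ∀ m → F (suc m) ≡ map pos (1 ∷ chainLabels 1 m)
F-suc m = cong (λ ls → map pos (1 ∷ ls)) (applyUpTo-chainLabels m id (λ _ → refl))

petrialGo-seen : ∀ {A seen l} s w → (A l ≡ true → l ∈ seen) →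
  petrialGo A seen ((s , l) ∷ w) ≡ (s , l) ∷ petrialGo A seen w
petrialGo-seen {A} {seen} {l} _ _ l-seen with A l | l ∈? seen
... | true  | yes _  = refl
... | true  | no l∉ = ⊥-elim (l∉ (l-seen refl))
... | false | _      = refl

petrialGo-chain : ∀ A k j seen → All (_≤ j) seen → (A j ≡ true → j ∈ seen) →
  ∃ λ ts → petrialGo A seen (map pos (chainLabels j k)) ≡ chain j ts
petrialGo-chain A zero    j seen _     j-seen = [] , petrialGo-seen ⊕ [] j-seen
petrialGo-chain A (suc k) j seen bound j-seen with A (suc j) in A1+j | suc j ∈? seen
... | true  | yes 1+j∈ = ⊥-elim (1+n≰n (All.lookup bound 1+j∈))
... | true  | no _
  with ts , eq ← petrialGo-chain A k (suc j) (suc j ∷ seen)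
                   (≤-refl ∷ All.map m≤n⇒m≤1+n bound) (λ _ → here refl)
  = ⊖ ∷ ts , cong ((⊖ , suc j) ∷_)
                 (trans (petrialGo-seen ⊕ _ (there ∘ j-seen)) (cong (pos j ∷_) eq))
... | false | _
  with ts , eq ← petrialGo-chain A k (suc j) seen
                   (All.map m≤n⇒m≤1+n bound) (⊥-elim ∘ not-¬ A1+j)
  = ⊕ ∷ ts , cong ((⊕ , suc j) ∷_)
                 (trans (petrialGo-seen ⊕ _ j-seen) (cong (pos j ∷_) eq))

partialPetrial-chain : ∀ A j k →
  ∃₂ λ s ts → partialPetrial (map pos (j ∷ chainLabels j k)) A ≡ (s , j) ∷ chain j ts
partialPetrial-chain A j k with A j in Aj
... | true
  with ts , eq ← petrialGo-chain A k j (j ∷ []) (≤-refl ∷ []) (λ _ → here refl)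
  = ⊖ , ts , cong ((⊖ , j) ∷_) eq
... | false
  with ts , eq ← petrialGo-chain A k j [] [] (⊥-elim ∘ not-¬ Aj)
  = ⊕ , ts , cong ((⊕ , j) ∷_) eq

lemma4p1 : ∀ (n : ℕ) (A : ℕ → Bool) →
    (partialPetrial (F n) A ⟶* []) ⊎
    ∃ (λ e → partialPetrial (F n) A ⟶* (pos e ∷ pos e ∷ []))
lemma4p1 zero    A = inj₁ ε
lemma4p1 (suc m) A with s , ts , eq ← partialPetrial-chain A 1 m =
  subst Reducible (sym (trans (cong (λ w → partialPetrial w A) (F-suc m)) eq))
    (reducible-chain ts 1 s)
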